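{- Let $a,b,c$ be commuting indeterminates and let $D$ be the derivation of $\mathbb{Q}[a,b,c]$ determined by $D(a)=ab$, $D(b)=b^2c$, $D(c)=bc^2$. Let $y_n(x)=\sum_{k=0}^n\frac{(n+k)!}{(n-k)!\,k!}\left(\frac{x}{2}\right)^k$ be the Bessel polynomials. Then for all $n\geq 0$, $$D^n(a^2b)=2^na^2b^{n+1}y_n\!\left(\frac{c}{2}\right).$$
   Context: $D$ is the formal derivative of the context-free grammar $\{a\rightarrow ab, b\rightarrow b^2c, c\rightarrow bc^2\}$, i.e. a linear map satisfying the Leibniz rule $D(uv)=D(u)v+uD(v)$; $D^0$ is the identity. -}

module Defs where

open import Data.Nat as ℕ using (ℕ; zero; suc; _∸_; _!)
open import Data.Nat.Properties using (_!≢0; m*n≢0)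
open import Data.Integer using (+_)
open import Relation.Binary.PropositionalEquality using (_≡_)
open import Data.Rational as ℚ using (ℚ; 0ℚ; 1ℚ; _/_)
open import Data.Rational using () renaming (_+_ to _+ℚ_; _*_ to _*ℚ_)

-- Polynomials in three commuting indeterminates a, b, c over ℚ, represented
-- by their coefficient function: p i j k = coefficient of a^i b^j c^k.
-- (Every element of ℚ[a,b,c] is such a function with finite support; all
-- objects of the theorem are polynomials built from the operations below.)
Poly : Set
Poly = ℕ → ℕ → ℕ → ℚ

sumTo : ℕ → (ℕ → ℚ) → ℚ
sumTo zero    f = f 0
sumTo (suc n) f = sumTo n f +ℚ f (suc n)

const : ℚ → Poly
const q zero zero zero = q
const q _    _    _    = 0ℚ

isOne : ℕ → ℚ
isOne 1 = 1ℚ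
isOne _ = 0ℚ

isZero : ℕ → ℚ
isZero 0 = 1ℚ
isZero _ = 0ℚ

varA varB varC : Poly
varA i j k = isOne i *ℚ isZero j *ℚ isZero k
varB i j k = isZero i *ℚ isOne j *ℚ isZero k
varC i j k = isZero i *ℚ isZero j *ℚ isOne k

infixl 6 _⊕_
infixl 7 _⊗_
infixr 8 _^^_

_⊕_ : Poly → Poly → Poly
(p ⊕ q) i j k = p i j k +ℚ q i j k

_⊗_ : Poly → Poly → Poly
(p ⊗ q) i j k =
  sumTo i λ i' → sumTo j λ j' → sumTo k λ k' →
    p i' j' k' *ℚ q (i ∸ i') (j ∸ j') (k ∸ k')

_^^_ : Poly → ℕ → Poly
p ^^ zero  = const 1ℚ
p ^^ suc n = p ⊗ (p ^^ n)

sumPoly : ℕ → (ℕ → Poly) → Poly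
sumPoly n f i j k = sumTo n (λ m → f m i j k)

ℕtoℚ : ℕ → ℚ
ℕtoℚ n = + n / 1

∂a ∂b ∂c : Poly → Poly
∂a p i j k = ℕtoℚ (suc i) *ℚ p (suc i) j k
∂b p i j k = ℕtoℚ (suc j) *ℚ p i (suc j) k
∂c p i j k = ℕtoℚ (suc k) *ℚ p i j (suc k)

D : Poly → Poly
D p = ∂a p ⊗ (varA ⊗ varB)
    ⊕ ∂b p ⊗ (varB ^^ 2 ⊗ varC)
    ⊕ ∂c p ⊗ (varB ⊗ varC ^^ 2)

D^ : ℕ → Poly → Poly
D^ zero    p = p
D^ (suc n) p = D (D^ n p)

besselCoeff : ℕ → ℕ → ℚ
besselCoeff n k = (+ ((n ℕ.+ k) !)) / ((n ∸ k) ! ℕ.* k !)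
  where instance _ = m*n≢0 ((n ∸ k) !) (k !) {{(n ∸ k) !≢0}} {{k !≢0}}

bessel : ℕ → Poly → Poly
bessel n x = sumPoly n λ k → const (besselCoeff n k) ⊗ (const (+ 1 / 2) ⊗ x) ^^ k

_≈P_ : Poly → Poly → Set
p ≈P q = ∀ i j k → p i j k ≡ q i j k

module Submission where

-- Every polynomial occurring in the theorem has the shape
--   AB α β f  =  a^α b^β · f(c),
-- with f : ℕ → ℚ the coefficient sequence of a polynomial in c alone.  On
-- such polynomials the ring operations of Defs become operations on
-- sequences: the product of a^α b^β f(c) and a^α' b^β' h(c) is
-- a^(α+α') b^(β+β') (f ⋆ h)(c), ⋆ the Cauchy product (lemma AB-⊗), and
-- D(a^(1+α) b^(1+β) f(c)) is again of this shape with an explicit sequence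
-- (lemma D-AB).  Hence D^n(a²b) = a² b^(n+1) γₙ(c) where γₙ satisfies
--   γₙ₊₁(k) = 2 γₙ(k) + (n+k) γₙ(k-1),
-- which is also the recurrence of γₙ(k) = 2ⁿ βₙ(k) (1/4)^k, where the
-- integers βₙ(k) = (n+k)!/((n-k)! k!) are the Bessel numbers.  The right hand
-- side of the theorem unfolds, by the same product rules, to
-- a² b^(n+1) · 2ⁿ Σₖ βₙ(k) (c/4)^k, which is the same polynomial.

open import Defs
open import Data.Nat using (ℕ)
open import Data.Integer using (+_)
open import Data.Rational using (_/_)

import Data.Nat as N
open N using (zero; suc; _∸_; _!; _≤_; _<_; z≤n; s≤s)
import Data.Nat.Properties as NP
import Data.Integer as Z
import Data.Integer.Properties as ZP
open import Data.Rational using (ℚ; 0ℚ; 1ℚ; ½; toℚᵘ)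
  renaming (_+_ to _+ℚ_; _*_ to _*ℚ_)
import Data.Rational.Properties as QP
import Data.Rational.Unnormalised as U
import Data.Rational.Unnormalised.Properties as UP
open import Data.Product using (Σ; _,_)
open import Relation.Nullary using (yes; no; contradiction)
open import Relation.Binary.PropositionalEquality
open import Algebra.Bundles using (CommutativeMonoid)
import Algebra.Properties.CommutativeSemigroup as CommutativeSemigroupProperties

module ℚ* = CommutativeSemigroupProperties (CommutativeMonoid.commutativeSemigroup QP.*-1-commutativeMonoid)

-- The cast ℕ → ℚ is a semiring homomorphism.  It is checked in the
-- unnormalised rationals, where n ↦ n/1 is additive and multiplicative
-- up to ≃, and transported back with toℚᵘ-injective.

toℚᵘ-ℕtoℚ : ∀ n → toℚᵘ (ℕtoℚ n) U.≃ U.mkℚᵘ (+ n) 0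
toℚᵘ-ℕtoℚ n = QP.toℚᵘ-fromℚᵘ (U.mkℚᵘ (+ n) 0)

ℕtoℚ-+ : ∀ m n → ℕtoℚ (m N.+ n) ≡ ℕtoℚ m +ℚ ℕtoℚ n
ℕtoℚ-+ m n = QP.toℚᵘ-injective (UP.≃-trans (toℚᵘ-ℕtoℚ (m N.+ n)) (UP.≃-trans unnormalised
  (UP.≃-sym (UP.≃-trans (QP.toℚᵘ-homo-+ (ℕtoℚ m) (ℕtoℚ n)) (UP.+-cong (toℚᵘ-ℕtoℚ m) (toℚᵘ-ℕtoℚ n))))))
  where
  open ≡-Reasoning
  unnormalised : U.mkℚᵘ (+ (m N.+ n)) 0 U.≃ (U.mkℚᵘ (+ m) 0 U.+ U.mkℚᵘ (+ n) 0)
  unnormalised = U.*≡* (begin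
    + (m N.+ n) Z.* + 1                    ≡⟨ ZP.*-identityʳ _ ⟩
    + (m N.+ n)                            ≡⟨ ZP.pos-+ m n ⟩
    + m Z.+ + n                            ≡⟨ cong₂ Z._+_ (sym (ZP.*-identityʳ (+ m))) (sym (ZP.*-identityʳ (+ n))) ⟩
    + m Z.* + 1 Z.+ + n Z.* + 1            ≡⟨ sym (ZP.*-identityʳ _) ⟩
    (+ m Z.* + 1 Z.+ + n Z.* + 1) Z.* + 1  ∎)

ℕtoℚ-* : ∀ m n → ℕtoℚ (m N.* n) ≡ ℕtoℚ m *ℚ ℕtoℚ n
ℕtoℚ-* m n = QP.toℚᵘ-injective (UP.≃-trans (toℚᵘ-ℕtoℚ (m N.* n)) (UP.≃-trans unnormalised
  (UP.≃-sym (UP.≃-trans (QP.toℚᵘ-homo-* (ℕtoℚ m) (ℕtoℚ n)) (UP.*-cong (toℚᵘ-ℕtoℚ m) (toℚᵘ-ℕtoℚ n))))))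
  where
  unnormalised : U.mkℚᵘ (+ (m N.* n)) 0 U.≃ (U.mkℚᵘ (+ m) 0 U.* U.mkℚᵘ (+ n) 0)
  unnormalised = U.*≡* (cong (Z._* + 1) (ZP.pos-* m n))

ℕtoℚ-/ : ∀ a c d .{{_ : N.NonZero d}} → c N.* d ≡ a → + a / d ≡ ℕtoℚ c
ℕtoℚ-/ a c (suc d) refl =
  QP.fromℚᵘ-cong {U.mkℚᵘ (+ (c N.* suc d)) d} {U.mkℚᵘ (+ c) 0}
    (U.*≡* (trans (ZP.*-identityʳ _) (ZP.pos-* c (suc d))))

-- Bessel numbers βₙ(k) = (n+k)!/((n-k)! k!), given by the recurrence
--   βₙ₊₁(k+1) = βₙ(k+1) + 2(n+k+1) βₙ(k),   βₙ(0) = 1,   β₀(k+1) = 0.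

besselℕ : ℕ → ℕ → ℕ
besselℕ zero    zero    = 1
besselℕ zero    (suc k) = 0
besselℕ (suc n) zero    = besselℕ n zero
besselℕ (suc n) (suc k) = besselℕ n (suc k) N.+ 2 N.* (n N.+ suc k) N.* besselℕ n k

besselℕ-n0 : ∀ n → besselℕ n 0 ≡ 1
besselℕ-n0 zero    = refl
besselℕ-n0 (suc n) = besselℕ-n0 n

besselℕ-above : ∀ n k → n < k → besselℕ n k ≡ 0
besselℕ-above zero    (suc k) _         = refl
besselℕ-above (suc n) (suc k) (s≤s n<k) = begin
  besselℕ n (suc k) N.+ 2 N.* (n N.+ suc k) N.* besselℕ n k
    ≡⟨ cong₂ (λ x y → x N.+ 2 N.* (n N.+ suc k) N.* y)
             (besselℕ-above n (suc k) (NP.m≤n⇒m≤1+n n<k)) (besselℕ-above n k n<k) ⟩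
  2 N.* (n N.+ suc k) N.* 0
    ≡⟨ NP.*-zeroʳ (2 N.* (n N.+ suc k)) ⟩
  0 ∎
  where open ≡-Reasoning

-- The two ring identities behind the factorial formula below: they are
-- the inductive steps with the inductive hypotheses substituted.
module FactorialSteps where
  open import Data.Nat.Solver using (module +-*-Solver)
  open +-*-Solver
  open ≡-Reasoning

  -- With n = k+1+d:  β(n+1, k+1)·(d+1)!(k+1)!  from the values at
  -- (n, k+1) and (n, k).
  inner : ∀ k d X Y F K D →
          X N.* (D N.* (suc k N.* K)) ≡ suc (k N.+ suc d N.+ k) N.* F →
          Y N.* (suc d N.* D N.* K) ≡ F →
          (X N.+ 2 N.* (k N.+ suc d N.+ suc k) N.* Y) N.* (suc d N.* D N.* (suc k N.* K))
            ≡ suc (suc (k N.+ suc d N.+ k)) N.* (suc (k N.+ suc d N.+ k) N.* F)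
  inner k d X Y F K D hX hY = begin
    (X N.+ 2 N.* (k N.+ suc d N.+ suc k) N.* Y) N.* (suc d N.* D N.* (suc k N.* K))
      ≡⟨ solve 7 (λ k d X Y F K D →
           (X :+ con 2 :* (k :+ (con 1 :+ d) :+ (con 1 :+ k)) :* Y) :* ((con 1 :+ d) :* D :* ((con 1 :+ k) :* K))
           := (con 1 :+ d) :* (X :* (D :* ((con 1 :+ k) :* K)))
              :+ (con 2 :* (k :+ (con 1 :+ d) :+ (con 1 :+ k)) :* (con 1 :+ k)) :* (Y :* ((con 1 :+ d) :* D :* K)))
           refl k d X Y F K D ⟩
    suc d N.* (X N.* (D N.* (suc k N.* K))) N.+ (2 N.* (k N.+ suc d N.+ suc k) N.* suc k) N.* (Y N.* (suc d N.* D N.* K))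
      ≡⟨ cong₂ (λ x y → suc d N.* x N.+ (2 N.* (k N.+ suc d N.+ suc k) N.* suc k) N.* y) hX hY ⟩
    suc d N.* (suc (k N.+ suc d N.+ k) N.* F) N.+ (2 N.* (k N.+ suc d N.+ suc k) N.* suc k) N.* F
      ≡⟨ solve 3 (λ k d F →
           (con 1 :+ d) :* ((con 1 :+ (k :+ (con 1 :+ d) :+ k)) :* F)
             :+ (con 2 :* (k :+ (con 1 :+ d) :+ (con 1 :+ k)) :* (con 1 :+ k)) :* F
           := (con 2 :+ (k :+ (con 1 :+ d) :+ k)) :* ((con 1 :+ (k :+ (con 1 :+ d) :+ k)) :* F))
           refl k d F ⟩
    suc (suc (k N.+ suc d N.+ k)) N.* (suc (k N.+ suc d N.+ k) N.* F) ∎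

  -- The diagonal n = k+1, where the value at (n, k+1) is zero.
  diagonal : ∀ k Y F K → Y N.* (1 N.* K) ≡ F →
             (0 N.+ 2 N.* suc (k N.+ k) N.* Y) N.* (1 N.* (suc k N.* K))
               ≡ suc (suc (k N.+ k)) N.* (suc (k N.+ k) N.* F)
  diagonal k Y F K hY = begin
    (0 N.+ 2 N.* suc (k N.+ k) N.* Y) N.* (1 N.* (suc k N.* K))
      ≡⟨ solve 3 (λ k Y K → (con 0 :+ con 2 :* (con 1 :+ (k :+ k)) :* Y) :* (con 1 :* ((con 1 :+ k) :* K))
                 := (con 2 :* (con 1 :+ (k :+ k)) :* (con 1 :+ k)) :* (Y :* (con 1 :* K))) refl k Y K ⟩
    (2 N.* suc (k N.+ k) N.* suc k) N.* (Y N.* (1 N.* K))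
      ≡⟨ cong ((2 N.* suc (k N.+ k) N.* suc k) N.*_) hY ⟩
    (2 N.* suc (k N.+ k) N.* suc k) N.* F
      ≡⟨ solve 2 (λ k F → (con 2 :* (con 1 :+ (k :+ k)) :* (con 1 :+ k)) :* F
                 := (con 2 :+ (k :+ k)) :* ((con 1 :+ (k :+ k)) :* F)) refl k F ⟩
    suc (suc (k N.+ k)) N.* (suc (k N.+ k) N.* F) ∎

  reassociate : ∀ k d → suc k N.+ d N.+ suc k ≡ suc (k N.+ suc d N.+ k)
  reassociate = solve 2 (λ k d → (con 1 :+ k) :+ d :+ (con 1 :+ k) := con 1 :+ (k :+ (con 1 :+ d) :+ k)) refl

besselℕ-factorial-diagonal : ∀ k → besselℕ (k N.+ 0) k N.* (1 N.* k !) ≡ (k N.+ 0 N.+ k) ! →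
  besselℕ (suc k N.+ 0) (suc k) N.* (1 N.* suc k !) ≡ (suc k N.+ 0 N.+ suc k) !
besselℕ-factorial-diagonal k ih
  rewrite NP.+-identityʳ k | besselℕ-above k (suc k) (NP.n<1+n k) | NP.+-suc k k =
  FactorialSteps.diagonal k (besselℕ k k) ((k N.+ k) !) (k !) ih

besselℕ-factorial : ∀ k d → besselℕ (k N.+ d) k N.* (d ! N.* k !) ≡ (k N.+ d N.+ k) !
besselℕ-factorial zero d rewrite besselℕ-n0 d | NP.+-identityʳ d =
  trans (NP.*-identityˡ _) (NP.*-identityʳ _)
besselℕ-factorial (suc k) zero = besselℕ-factorial-diagonal k (besselℕ-factorial k zero)
besselℕ-factorial (suc k) (suc d) =
  trans (FactorialSteps.inner k d (besselℕ (k N.+ suc d) (suc k)) (besselℕ (k N.+ suc d) k)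
           ((k N.+ suc d N.+ k) !) (k !) (d !) firstIH (besselℕ-factorial k (suc d)))
        (cong _! (sym (cong suc (NP.+-suc (k N.+ suc d) k))))
  where
  firstIH : besselℕ (k N.+ suc d) (suc k) N.* (d ! N.* (suc k N.* k !))
              ≡ suc (k N.+ suc d N.+ k) N.* (k N.+ suc d N.+ k) !
  firstIH = trans (cong (λ m → besselℕ m (suc k) N.* (d ! N.* (suc k N.* k !))) (NP.+-suc k d))
                  (trans (besselℕ-factorial (suc k) d) (cong _! (FactorialSteps.reassociate k d)))

≤⇒+ : ∀ {k n} → k ≤ n → Σ ℕ (λ d → n ≡ k N.+ d)
≤⇒+ {k} {n} k≤n = n ∸ k , sym (NP.m+[n∸m]≡n k≤n)

besselCoeff≡besselℕ : ∀ n k → k ≤ n → besselCoeff n k ≡ ℕtoℚ (besselℕ n k)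
besselCoeff≡besselℕ n k k≤n with ≤⇒+ k≤n
... | d , refl =
  ℕtoℚ-/ ((k N.+ d N.+ k) !) (besselℕ (k N.+ d) k) ((k N.+ d ∸ k) ! N.* k !)
    {{NP.m*n≢0 ((k N.+ d ∸ k) !) (k !) {{(k N.+ d ∸ k) NP.!≢0}} {{k NP.!≢0}}}}
    (subst (λ m → besselℕ (k N.+ d) k N.* (m ! N.* k !) ≡ (k N.+ d N.+ k) !)
           (sym (NP.m+n∸m≡n k d)) (besselℕ-factorial k d))

-- The sequences γₙ(k) = 2ⁿ βₙ(k) (1/4)^k; γₙ(c) will turn out to be
-- D^n(a²b) / (a² b^(n+1)).

infixr 8 _^ℚ_
_^ℚ_ : ℚ → ℕ → ℚ
q ^ℚ zero  = 1ℚ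
q ^ℚ suc n = q *ℚ q ^ℚ n

1^ℚ : ∀ n → 1ℚ ^ℚ n ≡ 1ℚ
1^ℚ zero    = refl
1^ℚ (suc n) = trans (QP.*-identityˡ (1ℚ ^ℚ n)) (1^ℚ n)

¼ : ℚ
¼ = ½ *ℚ ½

γ : ℕ → ℕ → ℚ
γ n k = ℕtoℚ (2 N.^ n) *ℚ (ℕtoℚ (besselℕ n k) *ℚ ¼ ^ℚ k)

γ-above : ∀ n k → n < k → γ n k ≡ 0ℚ
γ-above n k n<k = begin
  ℕtoℚ (2 N.^ n) *ℚ (ℕtoℚ (besselℕ n k) *ℚ ¼ ^ℚ k)
    ≡⟨ cong (λ b → ℕtoℚ (2 N.^ n) *ℚ (ℕtoℚ b *ℚ ¼ ^ℚ k)) (besselℕ-above n k n<k) ⟩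
  ℕtoℚ (2 N.^ n) *ℚ (0ℚ *ℚ ¼ ^ℚ k)
    ≡⟨ cong (ℕtoℚ (2 N.^ n) *ℚ_) (QP.*-zeroˡ (¼ ^ℚ k)) ⟩
  ℕtoℚ (2 N.^ n) *ℚ 0ℚ
    ≡⟨ QP.*-zeroʳ (ℕtoℚ (2 N.^ n)) ⟩
  0ℚ ∎
  where open ≡-Reasoning

module γ-Recurrence where
  open import Data.Rational.Solver using (module +-*-Solver)
  open +-*-Solver
  open ≡-Reasoning

  two : ℚ
  two = ℕtoℚ 2

  γ-suc-zero : ∀ n → γ (suc n) 0 ≡ two *ℚ γ n 0
  γ-suc-zero n = begin
    ℕtoℚ (2 N.* 2 N.^ n) *ℚ (ℕtoℚ (besselℕ n 0) *ℚ 1ℚ)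
      ≡⟨ cong (_*ℚ (ℕtoℚ (besselℕ n 0) *ℚ 1ℚ)) (ℕtoℚ-* 2 (2 N.^ n)) ⟩
    two *ℚ ℕtoℚ (2 N.^ n) *ℚ (ℕtoℚ (besselℕ n 0) *ℚ 1ℚ)
      ≡⟨ solve 2 (λ X Y → con two :* X :* (Y :* con 1ℚ) := con two :* (X :* (Y :* con 1ℚ)))
               refl (ℕtoℚ (2 N.^ n)) (ℕtoℚ (besselℕ n 0)) ⟩
    two *ℚ γ n 0 ∎

  γ-suc-suc : ∀ n k → γ (suc n) (suc k) ≡ two *ℚ γ n (suc k) +ℚ ℕtoℚ (n N.+ suc k) *ℚ γ n k
  γ-suc-suc n k = begin
    ℕtoℚ (2 N.* 2 N.^ n) *ℚ (ℕtoℚ (besselℕ n (suc k) N.+ 2 N.* (n N.+ suc k) N.* besselℕ n k) *ℚ (¼ *ℚ P))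
      ≡⟨ cong₂ (λ x y → x *ℚ (y *ℚ (¼ *ℚ P))) (ℕtoℚ-* 2 (2 N.^ n)) castBessel ⟩
    (two *ℚ X) *ℚ ((Y +ℚ (two *ℚ W) *ℚ Z) *ℚ (¼ *ℚ P))
      ≡⟨ solve 5 (λ X Y Z W P →
           (con two :* X) :* ((Y :+ (con two :* W) :* Z) :* (con ¼ :* P))
           := con two :* (X :* (Y :* (con ¼ :* P))) :+ W :* (X :* (Z :* P))) refl X Y Z W P ⟩
    two *ℚ γ n (suc k) +ℚ W *ℚ γ n k ∎
    where
    X = ℕtoℚ (2 N.^ n)
    Y = ℕtoℚ (besselℕ n (suc k))
    Z = ℕtoℚ (besselℕ n k)
    W = ℕtoℚ (n N.+ suc k)
    P = ¼ ^ℚ k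
    castBessel : ℕtoℚ (besselℕ n (suc k) N.+ 2 N.* (n N.+ suc k) N.* besselℕ n k) ≡ Y +ℚ (two *ℚ W) *ℚ Z
    castBessel = begin
      ℕtoℚ (besselℕ n (suc k) N.+ 2 N.* (n N.+ suc k) N.* besselℕ n k)
        ≡⟨ ℕtoℚ-+ (besselℕ n (suc k)) _ ⟩
      Y +ℚ ℕtoℚ (2 N.* (n N.+ suc k) N.* besselℕ n k)
        ≡⟨ cong (Y +ℚ_) (ℕtoℚ-* (2 N.* (n N.+ suc k)) (besselℕ n k)) ⟩
      Y +ℚ ℕtoℚ (2 N.* (n N.+ suc k)) *ℚ Z
        ≡⟨ cong (λ x → Y +ℚ x *ℚ Z) (ℕtoℚ-* 2 (n N.+ suc k)) ⟩
      Y +ℚ (two *ℚ W) *ℚ Z ∎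

open γ-Recurrence using (γ-suc-zero; γ-suc-suc)

sumTo-cong : ∀ n {F H : ℕ → ℚ} → (∀ x → x ≤ n → F x ≡ H x) → sumTo n F ≡ sumTo n H
sumTo-cong zero    F≡H = F≡H 0 z≤n
sumTo-cong (suc n) F≡H =
  cong₂ _+ℚ_ (sumTo-cong n (λ x x≤n → F≡H x (NP.m≤n⇒m≤1+n x≤n))) (F≡H (suc n) NP.≤-refl)

sumTo-zero : ∀ n (F : ℕ → ℚ) → (∀ x → x ≤ n → F x ≡ 0ℚ) → sumTo n F ≡ 0ℚ
sumTo-zero n F F≡0 = trans (sumTo-cong n F≡0) (constZero n)
  where
  constZero : ∀ n → sumTo n (λ _ → 0ℚ) ≡ 0ℚ
  constZero zero    = refl
  constZero (suc n) = trans (cong (_+ℚ 0ℚ) (constZero n)) (QP.+-identityʳ 0ℚ)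

sumTo-single : ∀ n m (F : ℕ → ℚ) → m ≤ n → (∀ x → x ≤ n → x ≢ m → F x ≡ 0ℚ) → sumTo n F ≡ F m
sumTo-single zero    zero F _ _ = refl
sumTo-single (suc n) m F m≤1+n F≡0 with m N.≟ suc n
... | yes refl = trans (cong (_+ℚ F (suc n)) (sumTo-zero n F below)) (QP.+-identityˡ (F (suc n)))
  where
  below : ∀ x → x ≤ n → F x ≡ 0ℚ
  below x x≤n = F≡0 x (NP.m≤n⇒m≤1+n x≤n) (NP.<⇒≢ (s≤s x≤n))
... | no m≢1+n = trans (cong₂ _+ℚ_ inner (F≡0 (suc n) NP.≤-refl (≢-sym m≢1+n))) (QP.+-identityʳ (F m))
  where
  inner : sumTo n F ≡ F m
  inner = sumTo-single n m F (NP.≤-pred (NP.≤∧≢⇒< m≤1+n m≢1+n))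
                       (λ x x≤n → F≡0 x (NP.m≤n⇒m≤1+n x≤n))

sumTo-*ˡ : ∀ n c (F : ℕ → ℚ) → sumTo n (λ x → c *ℚ F x) ≡ c *ℚ sumTo n F
sumTo-*ˡ zero    c F = refl
sumTo-*ˡ (suc n) c F =
  trans (cong (_+ℚ c *ℚ F (suc n)) (sumTo-*ˡ n c F)) (sym (QP.*-distribˡ-+ c (sumTo n F) (F (suc n))))

sumTo-*ʳ : ∀ n c (F : ℕ → ℚ) → sumTo n (λ x → F x *ℚ c) ≡ sumTo n F *ℚ c
sumTo-*ʳ zero    c F = refl
sumTo-*ʳ (suc n) c F =
  trans (cong (_+ℚ F (suc n) *ℚ c) (sumTo-*ʳ n c F)) (sym (QP.*-distribʳ-+ c (sumTo n F) (F (suc n))))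

δ : ℕ → ℕ → ℚ
δ zero    zero    = 1ℚ
δ zero    (suc _) = 0ℚ
δ (suc _) zero    = 0ℚ
δ (suc x) (suc a) = δ x a

δ-refl : ∀ a → δ a a ≡ 1ℚ
δ-refl zero    = refl
δ-refl (suc a) = δ-refl a

δ-≢ : ∀ {x a} → x ≢ a → δ x a ≡ 0ℚ
δ-≢ {zero}  {zero}  x≢a = contradiction refl x≢a
δ-≢ {zero}  {suc a} _   = refl
δ-≢ {suc x} {zero}  _   = refl
δ-≢ {suc x} {suc a} x≢a = δ-≢ (λ x≡a → x≢a (cong suc x≡a))

δ-shift : ∀ s x a → δ (s N.+ x) (s N.+ a) ≡ δ x a
δ-shift zero    x a = refl
δ-shift (suc s) x a = δ-shift s x a

δ-weight : ∀ (F : ℕ → ℚ) x a → F x *ℚ δ x a ≡ F a *ℚ δ x a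
δ-weight F x a with x N.≟ a
... | yes refl = refl
... | no x≢a   = trans (cong (F x *ℚ_) (δ-≢ x≢a))
                       (trans (QP.*-zeroʳ (F x)) (sym (trans (cong (F a *ℚ_) (δ-≢ x≢a)) (QP.*-zeroʳ (F a)))))

δ-conv : ∀ i a b → sumTo i (λ x → δ x a *ℚ δ (i ∸ x) b) ≡ δ i (a N.+ b)
δ-conv i a b with a N.≤? i
... | no a≰i = trans (sumTo-zero i _ offDiagonal) (sym (δ-≢ (λ i≡a+b → a≰i (subst (a ≤_) (sym i≡a+b) (NP.m≤m+n a b)))))
  where
  offDiagonal : ∀ x → x ≤ i → δ x a *ℚ δ (i ∸ x) b ≡ 0ℚ
  offDiagonal x x≤i = trans (cong (_*ℚ δ (i ∸ x) b) (δ-≢ (λ x≡a → a≰i (subst (_≤ i) x≡a x≤i))))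
                            (QP.*-zeroˡ (δ (i ∸ x) b))
... | yes a≤i with ≤⇒+ a≤i
...   | d , refl = begin
  sumTo (a N.+ d) (λ x → δ x a *ℚ δ (a N.+ d ∸ x) b)
    ≡⟨ sumTo-single (a N.+ d) a _ a≤i offDiagonal ⟩
  δ a a *ℚ δ (a N.+ d ∸ a) b
    ≡⟨ cong₂ _*ℚ_ (δ-refl a) (cong (λ y → δ y b) (NP.m+n∸m≡n a d)) ⟩
  1ℚ *ℚ δ d b
    ≡⟨ QP.*-identityˡ (δ d b) ⟩
  δ d b
    ≡⟨ sym (δ-shift a d b) ⟩
  δ (a N.+ d) (a N.+ b) ∎
  where
  open ≡-Reasoning
  offDiagonal : ∀ x → x ≤ a N.+ d → x ≢ a → δ x a *ℚ δ (a N.+ d ∸ x) b ≡ 0ℚ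
  offDiagonal x _ x≢a = trans (cong (_*ℚ δ (a N.+ d ∸ x) b) (δ-≢ x≢a)) (QP.*-zeroˡ (δ (a N.+ d ∸ x) b))

Seq : Set
Seq = ℕ → ℚ

infix 4 _≈S_
_≈S_ : Seq → Seq → Set
f ≈S h = ∀ k → f k ≡ h k

infixl 7 _⋆_
_⋆_ : Seq → Seq → Seq
(f ⋆ h) k = sumTo k (λ z → f z *ℚ h (k ∸ z))

cMono : ℚ → ℕ → Seq
cMono q m k = q *ℚ δ k m

cMono-⋆ : ∀ q m r m' → cMono q m ⋆ cMono r m' ≈S cMono (q *ℚ r) (m N.+ m')
cMono-⋆ q m r m' k = begin
  sumTo k (λ z → (q *ℚ δ z m) *ℚ (r *ℚ δ (k ∸ z) m'))
    ≡⟨ sumTo-cong k (λ z _ → ℚ*.interchange q (δ z m) r (δ (k ∸ z) m')) ⟩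
  sumTo k (λ z → (q *ℚ r) *ℚ (δ z m *ℚ δ (k ∸ z) m'))
    ≡⟨ sumTo-*ˡ k (q *ℚ r) _ ⟩
  (q *ℚ r) *ℚ sumTo k (λ z → δ z m *ℚ δ (k ∸ z) m')
    ≡⟨ cong ((q *ℚ r) *ℚ_) (δ-conv k m m') ⟩
  (q *ℚ r) *ℚ δ k (m N.+ m') ∎
  where open ≡-Reasoning

cMono0-⋆ : ∀ q f → cMono q 0 ⋆ f ≈S (λ k → q *ℚ f k)
cMono0-⋆ q f k = begin
  sumTo k (λ z → (q *ℚ δ z 0) *ℚ f (k ∸ z))
    ≡⟨ sumTo-single k 0 _ z≤n (λ z _ z≢0 → trans (cong (λ d → (q *ℚ d) *ℚ f (k ∸ z)) (δ-≢ z≢0))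
                                                 (trans (cong (_*ℚ f (k ∸ z)) (QP.*-zeroʳ q)) (QP.*-zeroˡ (f (k ∸ z))))) ⟩
  (q *ℚ 1ℚ) *ℚ f k
    ≡⟨ cong (_*ℚ f k) (QP.*-identityʳ q) ⟩
  q *ℚ f k ∎
  where open ≡-Reasoning

⋆-cMono : ∀ f q m k → m ≤ k → (f ⋆ cMono q m) k ≡ f (k ∸ m) *ℚ q
⋆-cMono f q m k m≤k with ≤⇒+ m≤k
... | d , refl = begin
  sumTo (m N.+ d) (λ z → f z *ℚ (q *ℚ δ (m N.+ d ∸ z) m))
    ≡⟨ sumTo-single (m N.+ d) d _ (NP.m≤n+m d m) offDiagonal ⟩
  f d *ℚ (q *ℚ δ (m N.+ d ∸ d) m)
    ≡⟨ cong (λ y → f d *ℚ (q *ℚ δ y m)) (NP.m+n∸n≡m m d) ⟩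
  f d *ℚ (q *ℚ δ m m)
    ≡⟨ cong (λ e → f d *ℚ (q *ℚ e)) (δ-refl m) ⟩
  f d *ℚ (q *ℚ 1ℚ)
    ≡⟨ cong₂ (λ x y → f x *ℚ y) (sym (NP.m+n∸m≡n m d)) (QP.*-identityʳ q) ⟩
  f (m N.+ d ∸ m) *ℚ q ∎
  where
  open ≡-Reasoning
  -- m + d - z = m forces z = d
  offDiagonal : ∀ z → z ≤ m N.+ d → z ≢ d → f z *ℚ (q *ℚ δ (m N.+ d ∸ z) m) ≡ 0ℚ
  offDiagonal z z≤m+d z≢d = trans (cong (λ e → f z *ℚ (q *ℚ e)) (δ-≢ notM))
                                  (trans (cong (f z *ℚ_) (QP.*-zeroʳ q)) (QP.*-zeroʳ (f z)))
    where
    notM : m N.+ d ∸ z ≢ m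
    notM eq = z≢d (NP.+-cancelˡ-≡ m z d
      (trans (NP.+-comm m z) (trans (cong (z N.+_) (sym eq)) (NP.m+[n∸m]≡n z≤m+d))))

⋆-cMono-below : ∀ f q m k → k < m → (f ⋆ cMono q m) k ≡ 0ℚ
⋆-cMono-below f q m k k<m = sumTo-zero k _ λ z _ →
  trans (cong (λ e → f z *ℚ (q *ℚ e)) (δ-≢ (NP.<⇒≢ (NP.≤-<-trans (NP.m∸n≤m k z) k<m))))
        (trans (cong (f z *ℚ_) (QP.*-zeroʳ q)) (QP.*-zeroʳ (f z)))

≈P-refl : ∀ p → p ≈P p
≈P-refl p i j k = refl

≈P-sym : ∀ {p q} → p ≈P q → q ≈P p
≈P-sym p≈q i j k = sym (p≈q i j k)

≈P-trans : ∀ {p q r} → p ≈P q → q ≈P r → p ≈P r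
≈P-trans p≈q q≈r i j k = trans (p≈q i j k) (q≈r i j k)

⊗-cong : ∀ {p p' q q'} → p ≈P p' → q ≈P q' → (p ⊗ q) ≈P (p' ⊗ q')
⊗-cong p≈p' q≈q' i j k =
  sumTo-cong i λ x _ → sumTo-cong j λ y _ → sumTo-cong k λ z _ →
    cong₂ _*ℚ_ (p≈p' x y z) (q≈q' (i ∸ x) (j ∸ y) (k ∸ z))

⊕-cong : ∀ {p p' q q'} → p ≈P p' → q ≈P q' → (p ⊕ q) ≈P (p' ⊕ q')
⊕-cong p≈p' q≈q' i j k = cong₂ _+ℚ_ (p≈p' i j k) (q≈q' i j k)

^^-cong : ∀ {p p'} → p ≈P p' → ∀ n → (p ^^ n) ≈P (p' ^^ n)
^^-cong p≈p' zero    i j k = refl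
^^-cong p≈p' (suc n) = ⊗-cong p≈p' (^^-cong p≈p' n)

D-cong : ∀ {p p'} → p ≈P p' → D p ≈P D p'
D-cong {p} {p'} p≈p' = ⊕-cong (⊕-cong (⊗-cong ∂a-cong (≈P-refl (varA ⊗ varB)))
                                       (⊗-cong ∂b-cong (≈P-refl (varB ^^ 2 ⊗ varC))))
                              (⊗-cong ∂c-cong (≈P-refl (varB ⊗ varC ^^ 2)))
  where
  ∂a-cong : ∂a p ≈P ∂a p'
  ∂a-cong i j k = cong (ℕtoℚ (suc i) *ℚ_) (p≈p' (suc i) j k)
  ∂b-cong : ∂b p ≈P ∂b p'
  ∂b-cong i j k = cong (ℕtoℚ (suc j) *ℚ_) (p≈p' i (suc j) k)
  ∂c-cong : ∂c p ≈P ∂c p'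
  ∂c-cong i j k = cong (ℕtoℚ (suc k) *ℚ_) (p≈p' i j (suc k))

AB : ℕ → ℕ → Seq → Poly
AB α β f i j k = δ i α *ℚ (δ j β *ℚ f k)

AB-cong : ∀ α β {f h} → f ≈S h → AB α β f ≈P AB α β h
AB-cong α β f≈h i j k = cong (λ x → δ i α *ℚ (δ j β *ℚ x)) (f≈h k)

AB-⊗ : ∀ α β f α' β' h → (AB α β f ⊗ AB α' β' h) ≈P AB (α N.+ α') (β N.+ β') (f ⋆ h)
AB-⊗ α β f α' β' h i j k = begin
  sumTo i (λ x → sumTo j λ y → sumTo k λ z →
    (δ x α *ℚ (δ y β *ℚ f z)) *ℚ (δ (i ∸ x) α' *ℚ (δ (j ∸ y) β' *ℚ h (k ∸ z))))
    ≡⟨ sumTo-cong i (λ x _ → sumTo-cong j λ y _ → sumTo-cong k λ z _ → regroup x y z) ⟩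
  sumTo i (λ x → sumTo j λ y → sumTo k λ z → u x *ℚ (v y *ℚ w z))
    ≡⟨ sumTo-cong i (λ x _ → sumTo-cong j λ y _ →
         trans (sumTo-*ˡ k (u x) _) (cong (u x *ℚ_) (sumTo-*ˡ k (v y) w))) ⟩
  sumTo i (λ x → sumTo j λ y → u x *ℚ (v y *ℚ (f ⋆ h) k))
    ≡⟨ sumTo-cong i (λ x _ → trans (sumTo-*ˡ j (u x) _) (cong (u x *ℚ_) (sumTo-*ʳ j ((f ⋆ h) k) v))) ⟩
  sumTo i (λ x → u x *ℚ (sumTo j v *ℚ (f ⋆ h) k))
    ≡⟨ sumTo-*ʳ i _ u ⟩
  sumTo i u *ℚ (sumTo j v *ℚ (f ⋆ h) k)
    ≡⟨ cong₂ (λ s t → s *ℚ (t *ℚ (f ⋆ h) k)) (δ-conv i α α') (δ-conv j β β') ⟩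
  δ i (α N.+ α') *ℚ (δ j (β N.+ β') *ℚ (f ⋆ h) k) ∎
  where
  open ≡-Reasoning
  u v w : ℕ → ℚ
  u x = δ x α *ℚ δ (i ∸ x) α'
  v y = δ y β *ℚ δ (j ∸ y) β'
  w z = f z *ℚ h (k ∸ z)
  regroup : ∀ x y z → (δ x α *ℚ (δ y β *ℚ f z)) *ℚ (δ (i ∸ x) α' *ℚ (δ (j ∸ y) β' *ℚ h (k ∸ z)))
                      ≡ u x *ℚ (v y *ℚ w z)
  regroup x y z = trans (ℚ*.interchange (δ x α) (δ y β *ℚ f z) (δ (i ∸ x) α') (δ (j ∸ y) β' *ℚ h (k ∸ z)))
                        (cong (u x *ℚ_) (ℚ*.interchange (δ y β) (f z) (δ (j ∸ y) β') (h (k ∸ z))))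

AB-⊗-at : ∀ {α β α' β' γ ε} f h → α N.+ α' ≡ γ → β N.+ β' ≡ ε →
          (AB α β f ⊗ AB α' β' h) ≈P AB γ ε (f ⋆ h)
AB-⊗-at {α} {β} {α'} {β'} f h refl refl = AB-⊗ α β f α' β' h

AB-⊕ : ∀ α β f h → (AB α β f ⊕ AB α β h) ≈P AB α β (λ k → f k +ℚ h k)
AB-⊕ α β f h i j k = trans (sym (QP.*-distribˡ-+ (δ i α) (δ j β *ℚ f k) (δ j β *ℚ h k)))
                           (cong (δ i α *ℚ_) (sym (QP.*-distribˡ-+ (δ j β) (f k) (h k))))

AB-sumPoly : ∀ n α β (F : ℕ → Seq) → sumPoly n (λ m → AB α β (F m)) ≈P AB α β (λ k → sumTo n (λ m → F m k))
AB-sumPoly n α β F i j k = trans (sumTo-*ˡ n (δ i α) _) (cong (δ i α *ℚ_) (sumTo-*ˡ n (δ j β) (λ m → F m k)))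

const-AB : ∀ q → const q ≈P AB 0 0 (cMono q 0)
const-AB q zero    zero    zero    =
  sym (trans (QP.*-identityˡ _) (trans (QP.*-identityˡ _) (QP.*-identityʳ q)))
const-AB q zero    zero    (suc k) =
  sym (trans (QP.*-identityˡ _) (trans (QP.*-identityˡ _) (QP.*-zeroʳ q)))
const-AB q zero    (suc j) k       = sym (trans (QP.*-identityˡ _) (QP.*-zeroˡ (q *ℚ δ k 0)))
const-AB q (suc i) j       k       = sym (QP.*-zeroˡ (δ j 0 *ℚ (q *ℚ δ k 0)))

isOne≡δ : ∀ i → isOne i ≡ δ i 1
isOne≡δ zero          = refl
isOne≡δ (suc zero)    = refl
isOne≡δ (suc (suc i)) = refl

isZero≡δ : ∀ i → isZero i ≡ δ i 0
isZero≡δ zero    = refl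
isZero≡δ (suc i) = refl

δδδ≡AB : ∀ α β m i j k → δ i α *ℚ δ j β *ℚ δ k m ≡ AB α β (cMono 1ℚ m) i j k
δδδ≡AB α β m i j k =
  trans (QP.*-assoc (δ i α) (δ j β) (δ k m))
        (cong (λ x → δ i α *ℚ (δ j β *ℚ x)) (sym (QP.*-identityˡ (δ k m))))

varA-AB : varA ≈P AB 1 0 (cMono 1ℚ 0)
varA-AB i j k = trans (cong₂ (λ x y → x *ℚ y *ℚ isZero k) (isOne≡δ i) (isZero≡δ j))
                      (trans (cong (δ i 1 *ℚ δ j 0 *ℚ_) (isZero≡δ k)) (δδδ≡AB 1 0 0 i j k))

varB-AB : varB ≈P AB 0 1 (cMono 1ℚ 0)
varB-AB i j k = trans (cong₂ (λ x y → x *ℚ y *ℚ isZero k) (isZero≡δ i) (isOne≡δ j))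
                      (trans (cong (δ i 0 *ℚ δ j 1 *ℚ_) (isZero≡δ k)) (δδδ≡AB 0 1 0 i j k))

varC-AB : varC ≈P AB 0 0 (cMono 1ℚ 1)
varC-AB i j k = trans (cong₂ (λ x y → x *ℚ y *ℚ isOne k) (isZero≡δ i) (isZero≡δ j))
                      (trans (cong (δ i 0 *ℚ δ j 0 *ℚ_) (isOne≡δ k)) (δδδ≡AB 0 0 1 i j k))

^^-AB : ∀ α β q m n →
        (AB α β (cMono q m) ^^ n) ≈P AB (n N.* α) (n N.* β) (cMono (q ^ℚ n) (n N.* m))
^^-AB α β q m zero    = const-AB 1ℚ
^^-AB α β q m (suc n) =
  ≈P-trans (⊗-cong (≈P-refl (AB α β (cMono q m))) (^^-AB α β q m n))
    (≈P-trans (AB-⊗ α β (cMono q m) (n N.* α) (n N.* β) (cMono (q ^ℚ n) (n N.* m)))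
              (AB-cong (suc n N.* α) (suc n N.* β) (cMono-⋆ q m (q ^ℚ n) (n N.* m))))

ab-AB : (varA ⊗ varB) ≈P AB 1 1 (cMono 1ℚ 0)
ab-AB = ≈P-trans (⊗-cong varA-AB varB-AB)
          (≈P-trans (AB-⊗ 1 0 (cMono 1ℚ 0) 0 1 (cMono 1ℚ 0)) (AB-cong 1 1 (cMono-⋆ 1ℚ 0 1ℚ 0)))

b²c-AB : (varB ^^ 2 ⊗ varC) ≈P AB 0 2 (cMono 1ℚ 1)
b²c-AB = ≈P-trans (⊗-cong (≈P-trans (^^-cong varB-AB 2) (^^-AB 0 1 1ℚ 0 2)) varC-AB)
           (≈P-trans (AB-⊗ 0 2 (cMono (1ℚ ^ℚ 2) 0) 0 0 (cMono 1ℚ 1))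
                     (AB-cong 0 2 (cMono-⋆ (1ℚ ^ℚ 2) 0 1ℚ 1)))

bc²-AB : (varB ⊗ varC ^^ 2) ≈P AB 0 1 (cMono 1ℚ 2)
bc²-AB = ≈P-trans (⊗-cong varB-AB (≈P-trans (^^-cong varC-AB 2) (^^-AB 0 0 1ℚ 1 2)))
           (≈P-trans (AB-⊗ 0 1 (cMono 1ℚ 0) 0 0 (cMono (1ℚ ^ℚ 2) 2))
                     (AB-cong 0 1 (cMono-⋆ 1ℚ 0 (1ℚ ^ℚ 2) 2)))

∂a-AB : ∀ α β f → ∂a (AB (suc α) β f) ≈P AB α β (λ k → ℕtoℚ (suc α) *ℚ f k)
∂a-AB α β f i j k = begin
  ℕtoℚ (suc i) *ℚ (δ i α *ℚ (δ j β *ℚ f k))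
    ≡⟨ sym (QP.*-assoc (ℕtoℚ (suc i)) (δ i α) _) ⟩
  ℕtoℚ (suc i) *ℚ δ i α *ℚ (δ j β *ℚ f k)
    ≡⟨ cong (_*ℚ (δ j β *ℚ f k)) (δ-weight (λ x → ℕtoℚ (suc x)) i α) ⟩
  ℕtoℚ (suc α) *ℚ δ i α *ℚ (δ j β *ℚ f k)
    ≡⟨ ℚ*.xy∙z≈y∙xz (ℕtoℚ (suc α)) (δ i α) _ ⟩
  δ i α *ℚ (ℕtoℚ (suc α) *ℚ (δ j β *ℚ f k))
    ≡⟨ cong (δ i α *ℚ_) (ℚ*.x∙yz≈y∙xz (ℕtoℚ (suc α)) (δ j β) (f k)) ⟩
  δ i α *ℚ (δ j β *ℚ (ℕtoℚ (suc α) *ℚ f k)) ∎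
  where open ≡-Reasoning

∂b-AB : ∀ α β f → ∂b (AB α (suc β) f) ≈P AB α β (λ k → ℕtoℚ (suc β) *ℚ f k)
∂b-AB α β f i j k = begin
  ℕtoℚ (suc j) *ℚ (δ i α *ℚ (δ j β *ℚ f k))
    ≡⟨ ℚ*.x∙yz≈y∙xz (ℕtoℚ (suc j)) (δ i α) _ ⟩
  δ i α *ℚ (ℕtoℚ (suc j) *ℚ (δ j β *ℚ f k))
    ≡⟨ cong (δ i α *ℚ_) (sym (QP.*-assoc (ℕtoℚ (suc j)) (δ j β) (f k))) ⟩
  δ i α *ℚ (ℕtoℚ (suc j) *ℚ δ j β *ℚ f k)
    ≡⟨ cong (λ x → δ i α *ℚ (x *ℚ f k)) (δ-weight (λ y → ℕtoℚ (suc y)) j β) ⟩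
  δ i α *ℚ (ℕtoℚ (suc β) *ℚ δ j β *ℚ f k)
    ≡⟨ cong (δ i α *ℚ_) (ℚ*.xy∙z≈y∙xz (ℕtoℚ (suc β)) (δ j β) (f k)) ⟩
  δ i α *ℚ (δ j β *ℚ (ℕtoℚ (suc β) *ℚ f k)) ∎
  where open ≡-Reasoning

∂c-AB : ∀ α β f → ∂c (AB α β f) ≈P AB α β (λ k → ℕtoℚ (suc k) *ℚ f (suc k))
∂c-AB α β f i j k =
  trans (ℚ*.x∙yz≈y∙xz (ℕtoℚ (suc k)) (δ i α) _)
        (cong (δ i α *ℚ_) (ℚ*.x∙yz≈y∙xz (ℕtoℚ (suc k)) (δ j β) (f (suc k))))

-- The coefficients of D(a^(1+α) b^(1+β) f(c)) / (a^(1+α) b^(2+β)):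
--   (1+α) f(k) + (1+β) f(k-1) + (k-1) f(k-1),
-- the last two terms being present for k ≥ 1 and k ≥ 2 respectively.
Dseq : ℕ → ℕ → Seq → Seq
Dseq α β f zero          = ℕtoℚ (suc α) *ℚ f 0
Dseq α β f (suc zero)    = ℕtoℚ (suc α) *ℚ f 1 +ℚ ℕtoℚ (suc β) *ℚ f 0
Dseq α β f (suc (suc k)) =
  ℕtoℚ (suc α) *ℚ f (suc (suc k)) +ℚ ℕtoℚ (suc β) *ℚ f (suc k) +ℚ ℕtoℚ (suc k) *ℚ f (suc k)

module DTerms (α β : ℕ) (f : Seq) where
  fa fb fc c⁰ c¹ c² : Seq
  fa z = ℕtoℚ (suc α) *ℚ f z
  fb z = ℕtoℚ (suc β) *ℚ f z
  fc z = ℕtoℚ (suc z) *ℚ f (suc z)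
  c⁰ = cMono 1ℚ 0
  c¹ = cMono 1ℚ 1
  c² = cMono 1ℚ 2

Dseq-⋆ : ∀ α β f → let open DTerms α β f in
  (λ k → (fa ⋆ c⁰) k +ℚ (fb ⋆ c¹) k +ℚ (fc ⋆ c²) k) ≈S Dseq α β f
Dseq-⋆ α β f zero = begin
  (fa ⋆ c⁰) 0 +ℚ (fb ⋆ c¹) 0 +ℚ (fc ⋆ c²) 0
    ≡⟨ cong₂ _+ℚ_ (cong₂ _+ℚ_ (⋆-cMono fa 1ℚ 0 0 z≤n) (⋆-cMono-below fb 1ℚ 1 0 (s≤s z≤n)))
                  (⋆-cMono-below fc 1ℚ 2 0 (s≤s z≤n)) ⟩
  fa 0 *ℚ 1ℚ +ℚ 0ℚ +ℚ 0ℚ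
    ≡⟨ trans (QP.+-identityʳ _) (trans (QP.+-identityʳ _) (QP.*-identityʳ (fa 0))) ⟩
  fa 0 ∎
  where
  open ≡-Reasoning
  open DTerms α β f
Dseq-⋆ α β f (suc zero) = begin
  (fa ⋆ c⁰) 1 +ℚ (fb ⋆ c¹) 1 +ℚ (fc ⋆ c²) 1
    ≡⟨ cong₂ _+ℚ_ (cong₂ _+ℚ_ (⋆-cMono fa 1ℚ 0 1 z≤n) (⋆-cMono fb 1ℚ 1 1 (s≤s z≤n)))
                  (⋆-cMono-below fc 1ℚ 2 1 (s≤s (s≤s z≤n))) ⟩
  fa 1 *ℚ 1ℚ +ℚ fb 0 *ℚ 1ℚ +ℚ 0ℚ
    ≡⟨ trans (QP.+-identityʳ _) (cong₂ _+ℚ_ (QP.*-identityʳ (fa 1)) (QP.*-identityʳ (fb 0))) ⟩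
  fa 1 +ℚ fb 0 ∎
  where
  open ≡-Reasoning
  open DTerms α β f
Dseq-⋆ α β f (suc (suc k)) = begin
  (fa ⋆ c⁰) (suc (suc k)) +ℚ (fb ⋆ c¹) (suc (suc k)) +ℚ (fc ⋆ c²) (suc (suc k))
    ≡⟨ cong₂ _+ℚ_ (cong₂ _+ℚ_ (⋆-cMono fa 1ℚ 0 (suc (suc k)) z≤n) (⋆-cMono fb 1ℚ 1 (suc (suc k)) (s≤s z≤n)))
                  (⋆-cMono fc 1ℚ 2 (suc (suc k)) (s≤s (s≤s z≤n))) ⟩
  fa (suc (suc k)) *ℚ 1ℚ +ℚ fb (suc k) *ℚ 1ℚ +ℚ fc k *ℚ 1ℚ
    ≡⟨ cong₂ _+ℚ_ (cong₂ _+ℚ_ (QP.*-identityʳ (fa (suc (suc k)))) (QP.*-identityʳ (fb (suc k))))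
                  (QP.*-identityʳ (fc k)) ⟩
  fa (suc (suc k)) +ℚ fb (suc k) +ℚ fc k ∎
  where
  open ≡-Reasoning
  open DTerms α β f

D-AB : ∀ α β f → D (AB (suc α) (suc β) f) ≈P AB (suc α) (suc (suc β)) (Dseq α β f)
D-AB α β f =
  ≈P-trans (⊕-cong (⊕-cong (⊗-cong (∂a-AB α (suc β) f) ab-AB) (⊗-cong (∂b-AB (suc α) β f) b²c-AB))
                   (⊗-cong (∂c-AB (suc α) (suc β) f) bc²-AB))
  (≈P-trans (⊕-cong (⊕-cong (AB-⊗-at fa c⁰ α+1 1+β+1) (AB-⊗-at fb c¹ 1+α+0 β+2))
                    (AB-⊗-at fc c² 1+α+0 1+β+1))
  (≈P-trans (⊕-cong (AB-⊕ (suc α) (suc (suc β)) (fa ⋆ c⁰) (fb ⋆ c¹)) (≈P-refl (AB (suc α) (suc (suc β)) (fc ⋆ c²))))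
  (≈P-trans (AB-⊕ (suc α) (suc (suc β)) _ (fc ⋆ c²))
            (AB-cong (suc α) (suc (suc β)) (Dseq-⋆ α β f)))))
  where
  open DTerms α β f
  α+1 : α N.+ 1 ≡ suc α
  α+1 = NP.+-comm α 1
  1+α+0 : suc α N.+ 0 ≡ suc α
  1+α+0 = NP.+-identityʳ (suc α)
  1+β+1 : suc β N.+ 1 ≡ suc (suc β)
  1+β+1 = cong suc (NP.+-comm β 1)
  β+2 : β N.+ 2 ≡ suc (suc β)
  β+2 = NP.+-comm β 2

Dseq-γ : ∀ n → Dseq 1 n (γ n) ≈S γ (suc n)
Dseq-γ n zero = sym (γ-suc-zero n)
Dseq-γ n (suc zero) = begin
  ℕtoℚ 2 *ℚ γ n 1 +ℚ ℕtoℚ (suc n) *ℚ γ n 0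
    ≡⟨ cong (λ m → ℕtoℚ 2 *ℚ γ n 1 +ℚ ℕtoℚ m *ℚ γ n 0) (NP.+-comm 1 n) ⟩
  ℕtoℚ 2 *ℚ γ n 1 +ℚ ℕtoℚ (n N.+ 1) *ℚ γ n 0
    ≡⟨ sym (γ-suc-suc n 0) ⟩
  γ (suc n) 1 ∎
  where open ≡-Reasoning
Dseq-γ n (suc (suc k)) = begin
  ℕtoℚ 2 *ℚ γ n (suc (suc k)) +ℚ ℕtoℚ (suc n) *ℚ γ n (suc k) +ℚ ℕtoℚ (suc k) *ℚ γ n (suc k)
    ≡⟨ QP.+-assoc (ℕtoℚ 2 *ℚ γ n (suc (suc k))) _ _ ⟩
  ℕtoℚ 2 *ℚ γ n (suc (suc k)) +ℚ (ℕtoℚ (suc n) *ℚ γ n (suc k) +ℚ ℕtoℚ (suc k) *ℚ γ n (suc k))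
    ≡⟨ cong (ℕtoℚ 2 *ℚ γ n (suc (suc k)) +ℚ_) (sym (QP.*-distribʳ-+ (γ n (suc k)) (ℕtoℚ (suc n)) (ℕtoℚ (suc k)))) ⟩
  ℕtoℚ 2 *ℚ γ n (suc (suc k)) +ℚ (ℕtoℚ (suc n) +ℚ ℕtoℚ (suc k)) *ℚ γ n (suc k)
    ≡⟨ cong (λ x → ℕtoℚ 2 *ℚ γ n (suc (suc k)) +ℚ x *ℚ γ n (suc k))
            (trans (sym (ℕtoℚ-+ (suc n) (suc k))) (cong ℕtoℚ (sym (NP.+-suc n (suc k))))) ⟩
  ℕtoℚ 2 *ℚ γ n (suc (suc k)) +ℚ ℕtoℚ (n N.+ suc (suc k)) *ℚ γ n (suc k)
    ≡⟨ sym (γ-suc-suc n (suc k)) ⟩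
  γ (suc n) (suc (suc k)) ∎
  where open ≡-Reasoning

a²b-AB : (varA ^^ 2 ⊗ varB) ≈P AB 2 1 (γ 0)
a²b-AB = ≈P-trans (⊗-cong (≈P-trans (^^-cong varA-AB 2) (^^-AB 1 0 1ℚ 0 2)) varB-AB)
           (≈P-trans (AB-⊗ 2 0 (cMono (1ℚ ^ℚ 2) 0) 0 1 (cMono 1ℚ 0))
                     (AB-cong 2 1 (λ k → trans (cMono-⋆ (1ℚ ^ℚ 2) 0 1ℚ 0 k) (γ₀ k))))
  where
  γ₀ : cMono 1ℚ 0 ≈S γ 0
  γ₀ zero    = refl
  γ₀ (suc k) = trans (QP.*-zeroʳ 1ℚ) (sym (trans (cong (1ℚ *ℚ_) (QP.*-zeroˡ (¼ ^ℚ suc k))) (QP.*-zeroʳ 1ℚ)))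

D^-a²b : ∀ n → D^ n (varA ^^ 2 ⊗ varB) ≈P AB 2 (suc n) (γ n)
D^-a²b zero    = a²b-AB
D^-a²b (suc n) = ≈P-trans (D-cong (D^-a²b n))
                          (≈P-trans (D-AB 1 n (γ n)) (AB-cong 2 (suc (suc n)) (Dseq-γ n)))

sumPoly-cong : ∀ n {F H : ℕ → Poly} → (∀ m → F m ≈P H m) → sumPoly n F ≈P sumPoly n H
sumPoly-cong n F≈H i j k = sumTo-cong n (λ m _ → F≈H m i j k)

prefactor-AB : ∀ n → (const (ℕtoℚ (2 N.^ n)) ⊗ varA ^^ 2 ⊗ varB ^^ suc n) ≈P AB 2 (suc n) (cMono (ℕtoℚ (2 N.^ n)) 0)
prefactor-AB n =
  ≈P-trans (⊗-cong (⊗-cong (const-AB C) (≈P-trans (^^-cong varA-AB 2) (^^-AB 1 0 1ℚ 0 2)))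
                   (≈P-trans (^^-cong varB-AB (suc n)) (^^-AB 0 1 1ℚ 0 (suc n))))
  (≈P-trans (⊗-cong (AB-⊗ 0 0 (cMono C 0) 2 0 (cMono (1ℚ ^ℚ 2) 0)) (≈P-refl (AB (suc n N.* 0) (suc n N.* 1) b^)))
  (≈P-trans (AB-⊗-at (cMono C 0 ⋆ cMono (1ℚ ^ℚ 2) 0) b^ (cong (2 N.+_) (NP.*-zeroʳ (suc n))) (NP.*-identityʳ (suc n)))
            (AB-cong 2 (suc n) coefficient)))
  where
  C = ℕtoℚ (2 N.^ n)
  b^ = cMono (1ℚ ^ℚ suc n) (suc n N.* 0)
  coefficient : (cMono C 0 ⋆ cMono (1ℚ ^ℚ 2) 0) ⋆ b^ ≈S cMono C 0
  coefficient k = begin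
    ((cMono C 0 ⋆ cMono (1ℚ ^ℚ 2) 0) ⋆ b^) k
      ≡⟨ sumTo-cong k (λ z _ → cong (_*ℚ b^ (k ∸ z)) (cMono-⋆ C 0 (1ℚ ^ℚ 2) 0 z)) ⟩
    (cMono (C *ℚ 1ℚ ^ℚ 2) 0 ⋆ b^) k
      ≡⟨ cMono-⋆ (C *ℚ 1ℚ ^ℚ 2) 0 (1ℚ ^ℚ suc n) (suc n N.* 0) k ⟩
    (C *ℚ 1ℚ ^ℚ 2) *ℚ 1ℚ ^ℚ suc n *ℚ δ k (suc n N.* 0)
      ≡⟨ cong₂ (λ x m → x *ℚ δ k m) powersOfOne (NP.*-zeroʳ (suc n)) ⟩
    C *ℚ δ k 0 ∎
    where
    open ≡-Reasoning
    powersOfOne : (C *ℚ 1ℚ ^ℚ 2) *ℚ 1ℚ ^ℚ suc n ≡ C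
    powersOfOne = trans (cong₂ _*ℚ_ (QP.*-identityʳ C) (1^ℚ (suc n))) (QP.*-identityʳ C)

bessel-AB : ∀ n → bessel n (const ½ ⊗ varC)
                    ≈P AB 0 0 (λ k → sumTo n (λ m → cMono (besselCoeff n m *ℚ ¼ ^ℚ m) m k))
bessel-AB n = ≈P-trans (sumPoly-cong n term) (AB-sumPoly n 0 0 _)
  where
  c/2 : (const ½ ⊗ varC) ≈P AB 0 0 (cMono ½ 1)
  c/2 = ≈P-trans (⊗-cong (const-AB ½) varC-AB)
          (≈P-trans (AB-⊗ 0 0 (cMono ½ 0) 0 0 (cMono 1ℚ 1)) (AB-cong 0 0 (cMono-⋆ ½ 0 1ℚ 1)))
  c/4 : (const ½ ⊗ (const ½ ⊗ varC)) ≈P AB 0 0 (cMono ¼ 1)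
  c/4 = ≈P-trans (⊗-cong (const-AB ½) c/2)
          (≈P-trans (AB-⊗ 0 0 (cMono ½ 0) 0 0 (cMono ½ 1)) (AB-cong 0 0 (cMono-⋆ ½ 0 ½ 1)))
  term : ∀ m → (const (besselCoeff n m) ⊗ (const ½ ⊗ (const ½ ⊗ varC)) ^^ m)
                 ≈P AB 0 0 (cMono (besselCoeff n m *ℚ ¼ ^ℚ m) m)
  term m = ≈P-trans (⊗-cong (const-AB (besselCoeff n m)) (≈P-trans (^^-cong c/4 m) (^^-AB 0 0 ¼ 1 m)))
             (≈P-trans (AB-⊗-at (cMono (besselCoeff n m) 0) (cMono (¼ ^ℚ m) (m N.* 1))
                                (NP.*-zeroʳ m) (NP.*-zeroʳ m))
                       (AB-cong 0 0 λ k → trans (cMono-⋆ (besselCoeff n m) 0 (¼ ^ℚ m) (m N.* 1) k)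
                                                (cong (λ e → besselCoeff n m *ℚ ¼ ^ℚ m *ℚ δ k e) (NP.*-identityʳ m))))

γ≡bessel : ∀ n k → γ n k ≡ ℕtoℚ (2 N.^ n) *ℚ sumTo n (λ m → cMono (besselCoeff n m *ℚ ¼ ^ℚ m) m k)
γ≡bessel n k with k N.≤? n
... | yes k≤n = sym (cong (ℕtoℚ (2 N.^ n) *ℚ_) (begin
  sumTo n (λ m → besselCoeff n m *ℚ ¼ ^ℚ m *ℚ δ k m)
    ≡⟨ sumTo-single n k _ k≤n (λ m _ m≢k → trans (cong (besselCoeff n m *ℚ ¼ ^ℚ m *ℚ_) (δ-≢ (≢-sym m≢k)))
                                                (QP.*-zeroʳ (besselCoeff n m *ℚ ¼ ^ℚ m))) ⟩
  besselCoeff n k *ℚ ¼ ^ℚ k *ℚ δ k k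
    ≡⟨ trans (cong (besselCoeff n k *ℚ ¼ ^ℚ k *ℚ_) (δ-refl k)) (QP.*-identityʳ _) ⟩
  besselCoeff n k *ℚ ¼ ^ℚ k
    ≡⟨ cong (_*ℚ ¼ ^ℚ k) (besselCoeff≡besselℕ n k k≤n) ⟩
  ℕtoℚ (besselℕ n k) *ℚ ¼ ^ℚ k ∎))
  where open ≡-Reasoning
... | no k≰n = trans (γ-above n k n<k) (sym (trans (cong (ℕtoℚ (2 N.^ n) *ℚ_) (sumTo-zero n _ vanish))
                                                    (QP.*-zeroʳ (ℕtoℚ (2 N.^ n)))))
  where
  n<k : n < k
  n<k = NP.≰⇒> k≰n
  vanish : ∀ m → m ≤ n → besselCoeff n m *ℚ ¼ ^ℚ m *ℚ δ k m ≡ 0ℚ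
  vanish m m≤n = trans (cong (besselCoeff n m *ℚ ¼ ^ℚ m *ℚ_) (δ-≢ (λ k≡m → k≰n (subst (_≤ n) (sym k≡m) m≤n))))
                       (QP.*-zeroʳ (besselCoeff n m *ℚ ¼ ^ℚ m))

rhs-AB : ∀ n → (const (+ (2 N.^ n) / 1) ⊗ varA ^^ 2 ⊗ varB ^^ suc n ⊗ bessel n (const (+ 1 / 2) ⊗ varC))
                 ≈P AB 2 (suc n) (γ n)
rhs-AB n = ≈P-trans (⊗-cong (prefactor-AB n) (bessel-AB n))
             (≈P-trans (AB-⊗-at (cMono C 0) bSeq (NP.+-identityʳ 2) (NP.+-identityʳ (suc n)))
                       (AB-cong 2 (suc n) λ k → trans (cMono0-⋆ C bSeq k) (sym (γ≡bessel n k))))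
  where
  C = ℕtoℚ (2 N.^ n)
  bSeq : Seq
  bSeq k = sumTo n (λ m → cMono (besselCoeff n m *ℚ ¼ ^ℚ m) m k)

mainTheorem2 : ∀ (n : ℕ) →
    D^ n (varA ^^ 2 ⊗ varB)
      ≈P (const (+ (2 Data.Nat.^ n) / 1) ⊗ varA ^^ 2 ⊗ varB ^^ (Data.Nat.suc n)
           ⊗ bessel n (const (+ 1 / 2) ⊗ varC))
mainTheorem2 n = ≈P-trans (D^-a²b n) (≈P-sym (rhs-AB n))
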